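{- Let $G$ be a graph with a matching $M$. Let $p$ be an even alternating path from $x$ to $y$ and $q$ an odd alternating path from $y$ to $z$. Then there is an odd alternating path from $x$ to either $y$ or $z$ whose length is at most $|p|+|q|$.
   Context: An alternating path is a path $p_0p_1\dots p_l$ whose first edge $p_0p_1$ is not in $M$ and whose edges alternate between not being in $M$ and being in $M$. Its length $|p|=l$ is its number of edges; it is even or odd according to the parity of $l$ (so an even alternating path ends with an edge of $M$ and an odd one ends with an edge not in $M$). -}

module Defs where

open import Data.Nat using (ℕ; zero; suc)
open import Data.Bool using (Bool; true; false; not; T)
open import Data.Fin using (Fin; zero; suc; toℕ; inject₁)
open import Data.Empty using (⊥)
open import Relation.Nullary using (¬_)
open import Relation.Binary.PropositionalEquality using (_≡_)
open import Level using (0ℓ) renaming (suc to lsuc)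

isEven : ℕ → Bool
isEven zero    = true
isEven (suc n) = not (isEven n)

Even : ℕ → Set
Even n = T (isEven n)

Odd : ℕ → Set
Odd n = T (not (isEven n))

record Graph (n : ℕ) : Set₁ where
  field
    Adj   : Fin n → Fin n → Set
    sym   : ∀ {u v} → Adj u v → Adj v u
    irrefl : ∀ {u} → ¬ Adj u u

record Matching {n : ℕ} (G : Graph n) : Set₁ where
  field
    InM      : Fin n → Fin n → Set
    sym      : ∀ {u v} → InM u v → InM v u
    ⊆E       : ∀ {u v} → InM u v → Graph.Adj G u v
    disjoint : ∀ {u v w} → InM u v → InM u w → v ≡ w

-- Condition on the i-th edge (0-indexed) of an alternating path:
-- edge 0 is not in M, edge 1 is in M, edge 2 is not, ...
AltCond : Set → ℕ → Set
AltCond P i with isEven i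
... | true  = ¬ P
... | false = P

record AltPath {n : ℕ} (G : Graph n) (M : Matching G) (x y : Fin n) (l : ℕ) : Set where
  field
    vtx      : Fin (suc l) → Fin n
    start    : vtx zero ≡ x
    end      : vtx (Data.Fin.fromℕ l) ≡ y
    distinct : ∀ i j → vtx i ≡ vtx j → i ≡ j
    edge     : ∀ (i : Fin l) → Graph.Adj G (vtx (inject₁ i)) (vtx (suc i))
    alt      : ∀ (i : Fin l) → AltCond (Matching.InM M (vtx (inject₁ i)) (vtx (suc i))) (toℕ i)

-- Walk along p until it first meets q, say p_i = q_j.  If i and j have the same
-- parity, the edge q_j q_{j+1} has the parity an edge in position i must have, so
-- p_0 … p_i q_{j+1} … q_{|q|} is alternating; its length i + |q| - j has the parity of
-- |q|, i.e. it is odd.  Otherwise the reversed edge q_j q_{j-1} fits instead and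
-- p_0 … p_i q_{j-1} … q_0 is an alternating path to y of odd length i + j.
-- Choosing the first meeting point makes both concatenations simple paths.
module Submission where

open import Defs
open import Data.Nat using (ℕ; zero; suc; _+_; _∸_; _≤_; _<_; _≤?_; _<?_; z≤n; s≤s; s≤s⁻¹)
open import Data.Nat.Properties
open import Data.Nat.Tactic.RingSolver using (solve-∀)
open import Data.Nat.DivMod using (_mod_; m<n⇒m%n≡m)
open import Data.Fin using (Fin; toℕ; fromℕ; fromℕ<; inject₁) renaming (zero to fzero; suc to fsuc)
open import Data.Fin.Properties using (toℕ-fromℕ<; toℕ-inject₁; toℕ-fromℕ; toℕ-injective; toℕ<n; toℕ≤pred[n])
  renaming (_≟_ to _≟ᶠ_)
open import Data.Bool using (true; false; not; T)
open import Data.Bool.Properties using (¬-not) renaming (_≟_ to _≟ᵇ_)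
open import Data.Product using (Σ; ∃; _×_; _,_)
open import Data.Sum using (_⊎_; inj₁; inj₂)
import Data.Sum as Sum
open import Data.Empty using (⊥-elim)
open import Relation.Nullary using (¬_; Dec; yes; no)
open import Relation.Unary using (Decidable)
open import Relation.Binary.PropositionalEquality
open import Function using (_∘_)

isEven-+ʳ : ∀ k {m n} → isEven m ≡ isEven n → isEven (k + m) ≡ isEven (k + n)
isEven-+ʳ zero    e = e
isEven-+ʳ (suc k) e = cong not (isEven-+ʳ k e)

isEven-+ˡ : ∀ {m n} k → isEven m ≡ isEven n → isEven (m + k) ≡ isEven (n + k)
isEven-+ˡ {m} {n} k e =
  trans (cong isEven (+-comm m k)) (trans (isEven-+ʳ k e) (cong isEven (+-comm k n)))

isEven-double : ∀ k → isEven (k + k) ≡ true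
isEven-double zero = refl
isEven-double (suc k) rewrite +-suc k k | isEven-double k = refl

isEven-+-double : ∀ m k → isEven (m + (k + k)) ≡ isEven m
isEven-+-double m k = trans (isEven-+ʳ m (isEven-double k)) (cong isEven (+-identityʳ m))

Odd-cong : ∀ {m n} → isEven m ≡ isEven n → Odd m → Odd n
Odd-cong e = subst (λ b → T (not b)) e

opposite-parity⇒Odd-+ : ∀ {i j} → isEven i ≢ isEven j → Odd (i + j)
opposite-parity⇒Odd-+ {i} {j} i≢j =
  Odd-cong {suc (j + j)} {i + j} (sym (isEven-+ˡ {i} {suc j} j (¬-not i≢j)))
    (subst (λ b → T (not (not b))) (sym (isEven-double j)) _)

AltCond-cong : ∀ {P} {i j} → isEven i ≡ isEven j → AltCond P i → AltCond P j
AltCond-cong {i = i} {j} e c with isEven i | isEven j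
AltCond-cong refl c | true  | true  = c
AltCond-cong refl c | false | false = c

AltCond-map : ∀ {P Q : Set} i → (P → Q) → (Q → P) → AltCond P i → AltCond Q i
AltCond-map i P→Q Q→P c with isEven i
... | true  = λ q → c (Q→P q)
... | false = P→Q c

first-witness : ∀ {P : ℕ → Set} → Decidable P → ∀ n → (∃ λ k → k ≤ n × P k) →
                ∃ λ i → i ≤ n × P i × (∀ {k} → k < i → ¬ P k)
first-witness P? zero (i , i≤0 , Pi) = i , i≤0 , Pi , λ k<i → ⊥-elim (n≮0 (<-≤-trans k<i i≤0))
first-witness P? (suc n) (i , i≤1+n , Pi) with anyUpTo? P? (suc n)
... | no  ¬below = i , i≤1+n , Pi , λ k<i Pk → ¬below (_ , <-≤-trans k<i i≤1+n , Pk)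
... | yes (k , k<1+n , Pk) with first-witness P? n (k , s≤s⁻¹ k<1+n , Pk)
...   | j , j≤n , Pj , least = j , m≤n⇒m≤1+n j≤n , Pj , least

record Meeting {n} (f g : ℕ → Fin n) (l m : ℕ) : Set where
  field
    i j   : ℕ
    i≤l   : i ≤ l
    j≤m   : j ≤ m
    meet  : f i ≡ g j
    first : ∀ {k j′} → k < i → j′ ≤ m → f k ≢ g j′

first-meeting : ∀ {n} (f g : ℕ → Fin n) {l m} → f l ≡ g 0 → Meeting f g l m
first-meeting f g {l} {m} fₗ≡g₀ =
  let i , i≤l , (j , j<1+m , meet) , least =
        first-witness Meets? l (l , ≤-refl , 0 , s≤s z≤n , fₗ≡g₀)
  in record { i = i ; j = j ; i≤l = i≤l ; j≤m = s≤s⁻¹ j<1+m ; meet = meet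
            ; first = λ k<i j′≤m e → least k<i (_ , s≤s j′≤m , e) }
  where
  Meets : ℕ → Set
  Meets k = ∃ λ j → j < suc m × f k ≡ g j
  Meets? : Decidable Meets
  Meets? k = anyUpTo? (λ j → f k ≟ᶠ g j) (suc m)

module AltSegments {n} {G : Graph n} (M : Matching G) where
  open Graph G using (Adj)
  open Matching M using (InM)

  record AltStep (i : ℕ) (u v : Fin n) : Set where
    constructor altStep
    field
      adj : Adj u v
      alt : AltCond (InM u v) i

  AltStep-resp : ∀ {i i′ u u′ v v′} → isEven i ≡ isEven i′ → u ≡ u′ → v ≡ v′ →
                 AltStep i u v → AltStep i′ u′ v′
  AltStep-resp {i} {i′} e refl refl (altStep uv c) = altStep uv (AltCond-cong {i = i} {i′} e c)

  AltStep-sym : ∀ {i u v} → AltStep i u v → AltStep i v u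
  AltStep-sym {i} (altStep uv c) =
    altStep (Graph.sym G uv) (AltCond-map i (Matching.sym M) (Matching.sym M) c)

  -- The stretch from position o to position o + l of an alternating path, indexed by ℕ;
  -- vtx k for k > l is junk.
  record AltSegment (o l : ℕ) (x y : Fin n) : Set where
    field
      vtx           : ℕ → Fin n
      head          : vtx 0 ≡ x
      last          : vtx l ≡ y
      vtx-injective : ∀ {i j} → i ≤ l → j ≤ l → vtx i ≡ vtx j → i ≡ j
      step          : ∀ {k} → k < l → AltStep (o + k) (vtx k) (vtx (suc k))
  open AltSegment public

  fromAltPath : ∀ {x y l} → AltPath G M x y l → AltSegment 0 l x y
  fromAltPath {x} {y} {l} p = record
    { vtx = v
    ; head = trans (sym (at fzero refl)) start
    ; last = trans (sym (at (fromℕ l) (toℕ-fromℕ l))) end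
    ; vtx-injective = λ i≤l j≤l e →
        trans (sym (toℕ-mod i≤l)) (trans (cong toℕ (distinct _ _ e)) (toℕ-mod j≤l))
    ; step = λ {k} k<l → let i = fromℕ< k<l in
        AltStep-resp {toℕ i} (cong isEven (toℕ-fromℕ< k<l))
          (at (inject₁ i) (trans (toℕ-inject₁ i) (toℕ-fromℕ< k<l)))
          (at (fsuc i) (cong suc (toℕ-fromℕ< k<l)))
          (altStep (edge i) (alt i))
    }
    where
    open AltPath p renaming (vtx to f)
    v : ℕ → Fin n
    v k = f (k mod suc l)
    toℕ-mod : ∀ {k} → k ≤ l → toℕ (k mod suc l) ≡ k
    toℕ-mod k≤l = trans (toℕ-fromℕ< _) (m<n⇒m%n≡m (s≤s k≤l))
    at : ∀ (i : Fin (suc l)) {k} → toℕ i ≡ k → f i ≡ v k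
    at i refl = cong f (toℕ-injective (sym (toℕ-mod (toℕ≤pred[n] i))))

  toAltPath : ∀ {x y l} → AltSegment 0 l x y → AltPath G M x y l
  toAltPath {l = l} s = record
    { vtx = λ i → vtx s (toℕ i)
    ; start = head s
    ; end = trans (cong (vtx s) (toℕ-fromℕ l)) (last s)
    ; distinct = λ i j e → toℕ-injective (vtx-injective s (toℕ≤pred[n] i) (toℕ≤pred[n] j) e)
    ; edge = λ i → AltStep.adj (step-at i)
    ; alt = λ i → AltStep.alt (step-at i)
    }
    where
    step-at : ∀ (i : Fin l) → AltStep (toℕ i) (vtx s (toℕ (inject₁ i))) (vtx s (suc (toℕ i)))
    step-at i = AltStep-resp refl (cong (vtx s) (sym (toℕ-inject₁ i))) refl (step s (toℕ<n i))

  take : ∀ {o l x y i y′} (s : AltSegment o l x y) → i ≤ l → vtx s i ≡ y′ → AltSegment o i x y′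
  take s i≤l sᵢ≡y′ = record
    { vtx = vtx s
    ; head = head s
    ; last = sᵢ≡y′
    ; vtx-injective = λ a≤i b≤i → vtx-injective s (≤-trans a≤i i≤l) (≤-trans b≤i i≤l)
    ; step = λ k<i → step s (<-≤-trans k<i i≤l)
    }

  drop : ∀ {o l x y} (s : AltSegment o l x y) j → j ≤ l → AltSegment (o + j) (l ∸ j) (vtx s j) y
  drop {o} {l} s j j≤l = record
    { vtx = λ t → vtx s (j + t)
    ; head = cong (vtx s) (+-identityʳ j)
    ; last = trans (cong (vtx s) (m+[n∸m]≡n j≤l)) (last s)
    ; vtx-injective = λ a≤ b≤ e → +-cancelˡ-≡ j _ _ (vtx-injective s (within a≤) (within b≤) e)
    ; step = λ {k} k< →
        AltStep-resp (cong isEven (sym (+-assoc o j k))) refl (cong (vtx s) (sym (+-suc j k)))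
          (step s (<-≤-trans (+-monoʳ-< j k<) (within ≤-refl)))
    }
    where
    within : ∀ {t} → t ≤ l ∸ j → j + t ≤ l
    within t≤ = ≤-trans (+-monoʳ-≤ j t≤) (≤-reflexive (m+[n∸m]≡n j≤l))

  shift : ∀ {o o′ l x y} → isEven o ≡ isEven o′ → AltSegment o l x y → AltSegment o′ l x y
  shift {o} {o′} e s = record
    { vtx = vtx s ; head = head s ; last = last s ; vtx-injective = vtx-injective s
    ; step = λ {k} k<l → AltStep-resp (isEven-+ˡ {o} {o′} k e) refl refl (step s k<l)
    }

  reverse-step : ∀ {o l x y} (s : AltSegment o l x y) {k} → k < l →
                 AltStep (suc (o + l) + k) (vtx s (l ∸ k)) (vtx s (l ∸ suc k))
  reverse-step {o} s {k} k<l with m≤n⇒∃[o]m+o≡n k<l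
  ... | d , refl = AltStep-sym (AltStep-resp parity
                     (cong (vtx s) (sym (m+n∸m≡n k d)))
                     (cong (vtx s) (sym (trans (+-∸-assoc 1 (m≤m+n k d)) (cong suc (m+n∸m≡n k d)))))
                     (step s (s≤s (m≤n+m d k))))
    where
    parity : isEven (o + d) ≡ isEven (suc (o + (suc k + d)) + k)
    parity = sym (trans (cong isEven (rearrange o k d)) (isEven-+-double (o + d) (suc k)))
      where
      rearrange : ∀ o k d → suc (o + (suc k + d)) + k ≡ (o + d) + (suc k + suc k)
      rearrange = solve-∀

  reverse : ∀ {o l x y} → AltSegment o l x y → AltSegment (suc (o + l)) l y x
  reverse {l = l} s = record
    { vtx = λ i → vtx s (l ∸ i)
    ; head = last s
    ; last = trans (cong (vtx s) (n∸n≡0 l)) (head s)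
    ; vtx-injective = λ {i} {j} i≤l j≤l e →
        ∸-cancelˡ-≡ i≤l j≤l (vtx-injective s (m∸n≤m l i) (m∸n≤m l j) e)
    ; step = reverse-step s
    }

  module _ {o a b x y z} (u : AltSegment o a x y) (w : AltSegment (o + a) b y z)
           (apart : ∀ {k k′} → k < a → k′ ≤ b → vtx u k ≢ vtx w k′) where
    private
      v : ℕ → Fin n
      v k with k ≤? a
      ... | yes _ = vtx u k
      ... | no  _ = vtx w (k ∸ a)

      v-≤ : ∀ {k} → k ≤ a → v k ≡ vtx u k
      v-≤ {k} k≤a with k ≤? a
      ... | yes _   = refl
      ... | no  k≰a = ⊥-elim (k≰a k≤a)

      v-< : ∀ {k} → k < a → v k ≡ vtx u k
      v-< = v-≤ ∘ <⇒≤

      v-+ : ∀ t → v (a + t) ≡ vtx w t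
      v-+ zero = trans (v-≤ (≤-reflexive (+-identityʳ a)))
                       (trans (cong (vtx u) (+-identityʳ a)) (trans (last u) (sym (head w))))
      v-+ (suc t) with a + suc t ≤? a
      ... | yes a+1+t≤a = ⊥-elim (m+1+n≰m a a+1+t≤a)
      ... | no  _       = cong (vtx w) (m+n∸m≡n a (suc t))

      split : ∀ k → k < a ⊎ ∃ λ t → a + t ≡ k
      split k with k <? a
      ... | yes k<a = inj₁ k<a
      ... | no  k≮a = inj₂ (m≤n⇒∃[o]m+o≡n (≮⇒≥ k≮a))

      injective : ∀ {i j} → i ≤ a + b → j ≤ a + b → v i ≡ v j → i ≡ j
      injective {i} {j} i≤ j≤ e with split i | split j
      ... | inj₁ i<a | inj₁ j<a =
        vtx-injective u (<⇒≤ i<a) (<⇒≤ j<a) (trans (sym (v-< i<a)) (trans e (v-< j<a)))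
      ... | inj₁ i<a | inj₂ (t , refl) =
        ⊥-elim (apart i<a (+-cancelˡ-≤ a t b j≤) (trans (sym (v-< i<a)) (trans e (v-+ t))))
      ... | inj₂ (t , refl) | inj₁ j<a =
        ⊥-elim (apart j<a (+-cancelˡ-≤ a t b i≤) (trans (sym (v-< j<a)) (trans (sym e) (v-+ t))))
      ... | inj₂ (t , refl) | inj₂ (t′ , refl) =
        cong (a +_) (vtx-injective w (+-cancelˡ-≤ a t b i≤) (+-cancelˡ-≤ a t′ b j≤)
                                     (trans (sym (v-+ t)) (trans e (v-+ t′))))

      steps : ∀ {k} → k < a + b → AltStep (o + k) (v k) (v (suc k))
      steps {k} k< with split k
      ... | inj₁ k<a = AltStep-resp refl (sym (v-< k<a)) (sym (v-≤ k<a)) (step u k<a)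
      ... | inj₂ (t , refl) =
        AltStep-resp (cong isEven (+-assoc o a t)) (sym (v-+ t))
          (sym (trans (cong v (sym (+-suc a t))) (v-+ (suc t))))
          (step w (+-cancelˡ-< a t b k<))

    join : AltSegment o (a + b) x z
    join = record
      { vtx = v
      ; head = trans (v-≤ z≤n) (head u)
      ; last = trans (v-+ b) (last w)
      ; vtx-injective = injective
      ; step = steps
      }

  module _ {x y z l m} (P : AltSegment 0 l x y) (Q : AltSegment 0 m y z)
           (c : Meeting (vtx P) (vtx Q) l m) where
    open Meeting c

    shortcut-forward : isEven i ≡ isEven j → AltSegment 0 (i + (m ∸ j)) x z
    shortcut-forward same = join (take P i≤l meet) (shift (sym same) (drop Q j j≤m))
      λ k<i k′≤ → first k<i (≤-trans (+-monoʳ-≤ j k′≤) (≤-reflexive (m+[n∸m]≡n j≤m)))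

    shortcut-backward : isEven i ≢ isEven j → AltSegment 0 (i + j) x y
    shortcut-backward differ =
      join (take P i≤l meet) (shift (sym (¬-not differ)) (reverse (take Q j≤m refl)))
        λ {_} {k′} k<i _ → first k<i (≤-trans (m∸n≤m j k′) j≤m)

  odd-path : ∀ {x y z l m} → AltSegment 0 l x y → AltSegment 0 m y z → Odd m →
             Σ ℕ λ k → (AltSegment 0 k x y ⊎ AltSegment 0 k x z) × Odd k × k ≤ l + m
  odd-path {x} {y} {z} {l} {m} P Q odd-m = by-parity (isEven i ≟ᵇ isEven j)
    where
    c : Meeting (vtx P) (vtx Q) l m
    c = first-meeting (vtx P) (vtx Q) (trans (last P) (sym (head Q)))
    open Meeting c
    by-parity : Dec (isEven i ≡ isEven j) →
                Σ ℕ λ k → (AltSegment 0 k x y ⊎ AltSegment 0 k x z) × Odd k × k ≤ l + m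
    by-parity (yes same) =
      i + (m ∸ j) , inj₂ (shortcut-forward P Q c same) ,
      Odd-cong {m} {i + (m ∸ j)}
        (sym (trans (isEven-+ˡ {i} {j} (m ∸ j) same) (cong isEven (m+[n∸m]≡n j≤m)))) odd-m ,
      +-mono-≤ i≤l (m∸n≤m m j)
    by-parity (no differ) =
      i + j , inj₁ (shortcut-backward P Q c differ) , opposite-parity⇒Odd-+ {i} differ ,
      +-mono-≤ i≤l j≤m

lemma5 : ∀ {n : ℕ} (G : Graph n) (M : Matching G) (x y z : Fin n) (l m : ℕ)
    → AltPath G M x y l → Even l
    → AltPath G M y z m → Odd m
    → Σ ℕ (λ k → (AltPath G M x y k ⊎ AltPath G M x z k) × Odd k × k ≤ l + m)
lemma5 G M x y z l m p _ q odd-m =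
  let k , path , odd-k , k≤l+m = odd-path (fromAltPath p) (fromAltPath q) odd-m
  in k , Sum.map toAltPath toAltPath path , odd-k , k≤l+m
  where open AltSegments M
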